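{- Let $S_0=\begin{pmatrix}0&1\\1&0\end{pmatrix}$ and $M_1=\begin{pmatrix}1_2&0\\S_0&1_2\end{pmatrix}$. Then $\{1_4,M_1\}$ is a complete set of representatives of the double coset space $\Gamma_0(2)\backslash Sp(2,\mathbb Z)/\Gamma_{\mathrm{diag}}$.
   Context: $\Gamma_0(2)=\{\begin{pmatrix}A&B\\C&D\end{pmatrix}\in Sp(2,\mathbb Z): C\equiv0\bmod 2\}$. $\Gamma_{\mathrm{diag}}$ is the image of $SL_2(\mathbb Z)\times SL_2(\mathbb Z)$ in $Sp(2,\mathbb Z)$ under $\iota\big(\begin{pmatrix}a_1&b_1\\c_1&d_1\end{pmatrix},\begin{pmatrix}a_2&b_2\\c_2&d_2\end{pmatrix}\big)=\begin{pmatrix}a_1&0&b_1&0\\0&a_2&0&b_2\\c_1&0&d_1&0\\0&c_2&0&d_2\end{pmatrix}$. -}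

module Defs where

open import Data.Nat using (ℕ)
open import Data.Integer using (ℤ; +_; -[1+_]; _+_; _*_; _-_; -_)
open import Data.Integer.Divisibility using (_∣_)
open import Data.Fin using (Fin; zero; suc; _↑ˡ_)
open import Data.Vec using (Vec; _∷_; []; lookup)
open import Data.Product using (_×_; Σ; ∃; ∃-syntax; _,_)
open import Relation.Binary.PropositionalEquality using (_≡_)
open import Relation.Nullary using (¬_)

Mat : ℕ → Set
Mat n = Fin n → Fin n → ℤ

_≈ₘ_ : {n : ℕ} → Mat n → Mat n → Set
A ≈ₘ B = ∀ i j → A i j ≡ B i j

fromRows : {n : ℕ} → Vec (Vec ℤ n) n → Mat n
fromRows rows i j = lookup (lookup rows i) j

sum4 : (Fin 4 → ℤ) → ℤ
sum4 f = f zero + (f (suc zero) + (f (suc (suc zero)) + f (suc (suc (suc zero)))))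

_·_ : Mat 4 → Mat 4 → Mat 4
(A · B) i j = sum4 (λ k → A i k * B k j)
infixl 7 _·_

transpose : Mat 4 → Mat 4
transpose A i j = A j i

J : Mat 4
J = fromRows ( (+ 0 ∷ + 0 ∷ + 1 ∷ + 0 ∷ [])
             ∷ (+ 0 ∷ + 0 ∷ + 0 ∷ + 1 ∷ [])
             ∷ (-[1+ 0 ] ∷ + 0 ∷ + 0 ∷ + 0 ∷ [])
             ∷ (+ 0 ∷ -[1+ 0 ] ∷ + 0 ∷ + 0 ∷ [])
             ∷ [])

one4 : Mat 4
one4 = fromRows ( (+ 1 ∷ + 0 ∷ + 0 ∷ + 0 ∷ [])
                ∷ (+ 0 ∷ + 1 ∷ + 0 ∷ + 0 ∷ [])
                ∷ (+ 0 ∷ + 0 ∷ + 1 ∷ + 0 ∷ [])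
                ∷ (+ 0 ∷ + 0 ∷ + 0 ∷ + 1 ∷ [])
                ∷ [])

InSp : Mat 4 → Set
InSp M = (transpose M · J · M) ≈ₘ J

-- Γ₀(2): symplectic with lower-left 2×2 block C ≡ 0 mod 2
InΓ₀2 : Mat 4 → Set
InΓ₀2 M = InSp M ×
  (∀ (i j : Fin 2) → (+ 2) ∣ M (suc (suc i)) (j ↑ˡ 2))

Mat2 : Set
Mat2 = Mat 2

det2 : Mat2 → ℤ
det2 g = g zero zero * g (suc zero) (suc zero) - g zero (suc zero) * g (suc zero) zero

InSL2 : Mat2 → Set
InSL2 g = det2 g ≡ + 1

ι : Mat2 → Mat2 → Mat 4
ι g h = fromRows ( (a1 ∷ + 0 ∷ b1 ∷ + 0 ∷ [])
                 ∷ (+ 0 ∷ a2 ∷ + 0 ∷ b2 ∷ [])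
                 ∷ (c1 ∷ + 0 ∷ d1 ∷ + 0 ∷ [])
                 ∷ (+ 0 ∷ c2 ∷ + 0 ∷ d2 ∷ [])
                 ∷ [])
  where
  a1 = g zero zero
  b1 = g zero (suc zero)
  c1 = g (suc zero) zero
  d1 = g (suc zero) (suc zero)
  a2 = h zero zero
  b2 = h zero (suc zero)
  c2 = h (suc zero) zero
  d2 = h (suc zero) (suc zero)

InΓdiag : Mat 4 → Set
InΓdiag M = ∃[ g ] ∃[ h ] (InSL2 g × InSL2 h × M ≈ₘ ι g h)

SameDoubleCoset : Mat 4 → Mat 4 → Set
SameDoubleCoset M N = ∃[ γ ] ∃[ δ ] (InΓ₀2 γ × InΓdiag δ × M ≈ₘ (γ · N · δ))

M₁ : Mat 4
M₁ = fromRows ( (+ 1 ∷ + 0 ∷ + 0 ∷ + 0 ∷ [])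
              ∷ (+ 0 ∷ + 1 ∷ + 0 ∷ + 0 ∷ [])
              ∷ (+ 0 ∷ + 1 ∷ + 1 ∷ + 0 ∷ [])
              ∷ (+ 1 ∷ + 0 ∷ + 0 ∷ + 1 ∷ [])
              ∷ [])

-- Reduced mod 2, the lower two rows of g ∈ Sp(2,ℤ) form a 2×4 matrix R over 𝔽₂, and a
-- finite search over all such R finds either a frame X = ι(G,H)⁻¹ r⁻¹ (G, H lifts of
-- elements of SL₂(𝔽₂), r ∈ {1₄, M₁}) whose first two columns R annihilates, or two vectors
-- x, y in the kernel of R with ω(x,y) odd.  In the first case g X ∈ Γ₀(2) and
-- g ∈ Γ₀(2) r Γ_diag; the second case cannot occur, because ω(x,y) = ω(gx,gy) and gx, gy
-- have even lower halves.  The two representatives are separated by the minor of rows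
-- {2,3} and columns {0,2} (counting from 0): right multiplication by ι(G,H) multiplies it
-- by det G, it is even on Γ₀(2), and it is −1 for M₁.

{-# OPTIONS --safe #-}
module Submission where

open import Defs
open import Data.Product using (_×_; _,_; ∃; ∃-syntax; proj₁; proj₂)
open import Data.Sum using (_⊎_; inj₁; inj₂; [_,_]′)
open import Relation.Nullary using (¬_; Dec; yes; no; ¬?)

open import Data.Bool using (Bool; true; false; not)
open import Data.Empty using (⊥-elim)
open import Data.Fin using (Fin; zero; suc; _↑ˡ_)
open import Data.Fin.Properties using (any?; all?)
open import Data.Integer using (ℤ; +_; -[1+_]; _+_; _*_; _-_; -_)
open import Data.Integer.Divisibility.Signed
  using (_∣_; divides; _∣?_; ∣ᵤ⇒∣; ∣⇒∣ᵤ; ∣m∣n⇒∣m+n; ∣m⇒∣-m; ∣m∣n⇒∣m-n; ∣n⇒∣m*n; ∣m⇒∣m*n)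
open import Data.Integer.Properties
  using (+-*-semiring; +-identityʳ; +-inverseʳ; *-comm; *-assoc; *-identityʳ; _≟_)
open import Algebra.Properties.Semiring.Sum +-*-semiring
  using (sum; sum-cong-≗; ∑-comm; *-distribˡ-sum; *-distribʳ-sum)
open import Data.Integer.Tactic.RingSolver using (solve-∀)
open import Data.Nat as ℕ using (ℕ)
open import Data.Nat.Divisibility using (∣1⇒≡1)
open import Data.Vec using (Vec; []; _∷_; lookup; tabulate)
open import Relation.Binary using (Setoid)
open import Relation.Binary.PropositionalEquality
  using (_≡_; refl; sym; trans; cong; cong₂; subst; module ≡-Reasoning)
open import Relation.Nullary.Decidable using (from-yes; map′; _×-dec_; _⊎-dec_; decidable-stable)
open import Relation.Unary using (Decidable)
import Relation.Binary.Reasoning.Setoid as SetoidReasoning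

pattern f0 = zero
pattern f1 = suc zero
pattern f2 = suc (suc zero)
pattern f3 = suc (suc (suc zero))

-- Exhaustive search over finite types

Exhaustible : Set → Set₁
Exhaustible A = ∀ {P : A → Set} → Decidable P → Dec (∃ P)

∃?-Bool : Exhaustible Bool
∃?-Bool P? = map′ [ (true ,_) , (false ,_) ]′ split (P? true ⊎-dec P? false)
  where
  split : ∀ {P} → ∃ P → P true ⊎ P false
  split (true , p) = inj₁ p
  split (false , p) = inj₂ p

∃?-× : ∀ {A B} → Exhaustible A → Exhaustible B → Exhaustible (A × B)
∃?-× ∃?A ∃?B P? = map′ (λ (a , b , p) → (a , b) , p) (λ ((a , b) , p) → a , b , p)
  (∃?A λ a → ∃?B λ b → P? (a , b))

∃?-Vec : ∀ {A} → Exhaustible A → ∀ n → Exhaustible (Vec A n)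
∃?-Vec ∃?A ℕ.zero P? = map′ ([] ,_) (λ { ([] , p) → p }) (P? [])
∃?-Vec ∃?A (ℕ.suc n) P? = map′ (λ (x , xs , p) → x ∷ xs , p) (λ { (x ∷ xs , p) → x , xs , p })
  (∃?A λ x → ∃?-Vec ∃?A n λ xs → P? (x ∷ xs))

∀? : ∀ {A} → Exhaustible A → ∀ {P : A → Set} → Decidable P → Dec (∀ x → P x)
∀? ∃?A P? with ∃?A (λ x → ¬? (P? x))
... | yes (x , ¬p) = no λ ∀p → ¬p (∀p x)
... | no ¬∃¬p = yes λ x → decidable-stable (P? x) λ ¬p → ¬∃¬p (x , ¬p)

-- Defs declares no fixity for _≈ₘ_.
infix 4 _≈_
_≈_ : Mat 4 → Mat 4 → Set
_≈_ = _≈ₘ_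

≈-setoid : Setoid _ _
≈-setoid = record
  { Carrier = Mat 4
  ; _≈_ = _≈_
  ; isEquivalence = record
    { refl = λ _ _ → refl
    ; sym = λ p i j → sym (p i j)
    ; trans = λ p q i j → trans (p i j) (q i j)
    }
  }

open Setoid ≈-setoid using () renaming (trans to ≈-trans)

infix 4 _≈?_
_≈?_ : (A B : Mat 4) → Dec (A ≈ B)
A ≈? B = all? λ i → all? λ j → A i j ≟ B i j

InSp? : ∀ M → Dec (InSp M)
InSp? M = transpose M · J · M ≈? J

sum4-cong : ∀ {f g} → (∀ k → f k ≡ g k) → sum4 f ≡ sum4 g
sum4-cong p = cong₂ _+_ (p f0) (cong₂ _+_ (p f1) (cong₂ _+_ (p f2) (p f3)))

sum4≡sum : ∀ f → sum4 f ≡ sum f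
sum4≡sum f = cong (λ z → f f0 + (f f1 + (f f2 + z))) (sym (+-identityʳ (f f3)))

·-assoc : ∀ A B C → (A · B) · C ≈ A · (B · C)
·-assoc A B C i j = begin
  sum4 (λ k → sum4 (λ l → A i l * B l k) * C k j)
    ≡⟨ sum4≡sum (λ k → sum4 (λ l → A i l * B l k) * C k j) ⟩
  sum (λ k → sum4 (λ l → A i l * B l k) * C k j)
    ≡⟨ sum-cong-≗ (λ k → cong (_* C k j) (sum4≡sum (λ l → A i l * B l k))) ⟩
  sum (λ k → sum (λ l → A i l * B l k) * C k j)
    ≡⟨ sum-cong-≗ (λ k → *-distribʳ-sum (C k j) (λ l → A i l * B l k)) ⟩
  sum (λ k → sum (λ l → A i l * B l k * C k j))
    ≡⟨ ∑-comm (λ k l → A i l * B l k * C k j) ⟩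
  sum (λ l → sum (λ k → A i l * B l k * C k j))
    ≡⟨ sum-cong-≗ (λ l → sum-cong-≗ (λ k → *-assoc (A i l) (B l k) (C k j))) ⟩
  sum (λ l → sum (λ k → A i l * (B l k * C k j)))
    ≡⟨ sum-cong-≗ (λ l → sym (*-distribˡ-sum (A i l) (λ k → B l k * C k j))) ⟩
  sum (λ l → A i l * sum (λ k → B l k * C k j))
    ≡⟨ sum-cong-≗ (λ l → cong (A i l *_) (sym (sum4≡sum (λ k → B l k * C k j)))) ⟩
  sum (λ l → A i l * sum4 (λ k → B l k * C k j))
    ≡⟨ sym (sum4≡sum (λ l → A i l * sum4 (λ k → B l k * C k j))) ⟩
  sum4 (λ l → A i l * sum4 (λ k → B l k * C k j))
    ∎
  where open ≡-Reasoning

·-congˡ : ∀ A {B C} → B ≈ C → A · B ≈ A · C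
·-congˡ A B≈C i j = sum4-cong λ k → cong (A i k *_) (B≈C k j)

·-congʳ : ∀ A {B C} → B ≈ C → B · A ≈ C · A
·-congʳ A B≈C i j = sum4-cong λ k → cong (_* A k j) (B≈C i k)

·-identityʳ : ∀ A → A · one4 ≈ A
·-identityʳ A i f0 = pick₀ (A i f0) (A i f1) (A i f2) (A i f3)
  where
  pick₀ : ∀ a b c d → a * + 1 + (b * + 0 + (c * + 0 + d * + 0)) ≡ a
  pick₀ = solve-∀
·-identityʳ A i f1 = pick₁ (A i f0) (A i f1) (A i f2) (A i f3)
  where
  pick₁ : ∀ a b c d → a * + 0 + (b * + 1 + (c * + 0 + d * + 0)) ≡ b
  pick₁ = solve-∀
·-identityʳ A i f2 = pick₂ (A i f0) (A i f1) (A i f2) (A i f3)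
  where
  pick₂ : ∀ a b c d → a * + 0 + (b * + 0 + (c * + 1 + d * + 0)) ≡ c
  pick₂ = solve-∀
·-identityʳ A i f3 = pick₃ (A i f0) (A i f1) (A i f2) (A i f3)
  where
  pick₃ : ∀ a b c d → a * + 0 + (b * + 0 + (c * + 0 + d * + 1)) ≡ d
  pick₃ = solve-∀

transpose-· : ∀ A B → transpose (A · B) ≈ transpose B · transpose A
transpose-· A B i j = sum4-cong λ k → *-comm (A j k) (B k i)

form-invariant : ∀ A B → InSp A → transpose (A · B) · J · (A · B) ≈ transpose B · J · B
form-invariant A B spA = begin
  transpose (A · B) · J · (A · B)           ≈⟨ ·-congʳ (A · B) (·-congʳ J (transpose-· A B)) ⟩
  Bᵀ · Aᵀ · J · (A · B)                     ≈⟨ ·-congʳ (A · B) (·-assoc Bᵀ Aᵀ J) ⟩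
  Bᵀ · (Aᵀ · J) · (A · B)                   ≈⟨ ·-assoc Bᵀ (Aᵀ · J) (A · B) ⟩
  Bᵀ · (Aᵀ · J · (A · B))                   ≈⟨ ·-congˡ Bᵀ (·-assoc (Aᵀ · J) A B) ⟨
  Bᵀ · (Aᵀ · J · A · B)                     ≈⟨ ·-congˡ Bᵀ (·-congʳ B spA) ⟩
  Bᵀ · (J · B)                              ≈⟨ ·-assoc Bᵀ J B ⟨
  Bᵀ · J · B                                ∎
  where
  open SetoidReasoning ≈-setoid
  Aᵀ Bᵀ : Mat 4
  Aᵀ = transpose A
  Bᵀ = transpose B

InSp-· : ∀ A B → InSp A → InSp B → InSp (A · B)
InSp-· A B spA spB = ≈-trans (form-invariant A B spA) spB

-- Congruence modulo 2

∣-sum4 : ∀ {d} f → (∀ k → d ∣ f k) → d ∣ sum4 f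
∣-sum4 _ p = ∣m∣n⇒∣m+n (p f0) (∣m∣n⇒∣m+n (p f1) (∣m∣n⇒∣m+n (p f2) (p f3)))

2∤-1 : ¬ + 2 ∣ -[1+ 0 ]
2∤-1 2∣-1 with ∣1⇒≡1 (∣⇒∣ᵤ 2∣-1)
... | ()

infix 4 _≡₂_
record _≡₂_ (x y : ℤ) : Set where
  constructor ≡₂-intro
  field 2∣x-y : + 2 ∣ x - y

≡₂-refl : ∀ {x} → x ≡₂ x
≡₂-refl {x} = ≡₂-intro (divides (+ 0) (+-inverseʳ x))

≡₂-trans : ∀ {x y z} → x ≡₂ y → y ≡₂ z → x ≡₂ z
≡₂-trans {x} {y} {z} (≡₂-intro p) (≡₂-intro q) = ≡₂-intro (subst (+ 2 ∣_) (telescope x y z) (∣m∣n⇒∣m+n p q))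
  where
  telescope : ∀ x y z → x - y + (y - z) ≡ x - z
  telescope = solve-∀

≡₂-+ : ∀ {x x′ y y′} → x ≡₂ x′ → y ≡₂ y′ → x + y ≡₂ x′ + y′
≡₂-+ {x} {x′} {y} {y′} (≡₂-intro p) (≡₂-intro q) = ≡₂-intro (subst (+ 2 ∣_) (regroup x x′ y y′) (∣m∣n⇒∣m+n p q))
  where
  regroup : ∀ x x′ y y′ → x - x′ + (y - y′) ≡ x + y - (x′ + y′)
  regroup = solve-∀

≡₂-* : ∀ {x x′ y y′} → x ≡₂ x′ → y ≡₂ y′ → x * y ≡₂ x′ * y′
≡₂-* {x} {x′} {y} {y′} (≡₂-intro p) (≡₂-intro q) =
  ≡₂-intro (subst (+ 2 ∣_) (regroup x x′ y y′) (∣m∣n⇒∣m+n (∣m⇒∣m*n y p) (∣n⇒∣m*n x′ q)))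
  where
  regroup : ∀ x x′ y y′ → (x - x′) * y + x′ * (y - y′) ≡ x * y - x′ * y′
  regroup = solve-∀

≡₂-neg : ∀ {x y} → x ≡₂ y → - x ≡₂ - y
≡₂-neg {x} {y} (≡₂-intro p) = ≡₂-intro (subst (+ 2 ∣_) (regroup x y) (∣m⇒∣-m p))
  where
  regroup : ∀ x y → - (x - y) ≡ - x - - y
  regroup = solve-∀

≡₂-sum4 : ∀ {f g} → (∀ k → f k ≡₂ g k) → sum4 f ≡₂ sum4 g
≡₂-sum4 p = ≡₂-+ (p f0) (≡₂-+ (p f1) (≡₂-+ (p f2) (p f3)))

∣-resp-≡₂ : ∀ {x y} → x ≡₂ y → + 2 ∣ y → + 2 ∣ x
∣-resp-≡₂ {x} {y} (≡₂-intro p) q = subst (+ 2 ∣_) (regroup x y) (∣m∣n⇒∣m+n p q)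
  where
  regroup : ∀ x y → x - y + y ≡ x
  regroup = solve-∀

⟦_⟧ : Bool → ℤ
⟦ false ⟧ = + 0
⟦ true ⟧ = + 1

parityℕ : ℕ → Bool
parityℕ ℕ.zero = false
parityℕ (ℕ.suc n) = not (parityℕ n)

parity : ℤ → Bool
parity (+ n) = parityℕ n
parity -[1+ n ] = parityℕ (ℕ.suc n)

≡₂-parityℕ : ∀ n → + n ≡₂ ⟦ parityℕ n ⟧
≡₂-parityℕ ℕ.zero = ≡₂-refl
≡₂-parityℕ (ℕ.suc n) = ≡₂-trans (≡₂-+ (≡₂-refl {+ 1}) (≡₂-parityℕ n)) (1+⟦⟧ (parityℕ n))
  where
  1+⟦⟧ : ∀ b → + 1 + ⟦ b ⟧ ≡₂ ⟦ not b ⟧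
  1+⟦⟧ false = ≡₂-refl
  1+⟦⟧ true = ≡₂-intro (divides (+ 1) refl)

≡₂-parity : ∀ x → x ≡₂ ⟦ parity x ⟧
≡₂-parity (+ n) = ≡₂-parityℕ n
≡₂-parity -[1+ n ] = ≡₂-trans (≡₂-neg (≡₂-parityℕ (ℕ.suc n))) (-⟦⟧ (parityℕ (ℕ.suc n)))
  where
  -⟦⟧ : ∀ b → - ⟦ b ⟧ ≡₂ ⟦ b ⟧
  -⟦⟧ false = ≡₂-refl
  -⟦⟧ true = ≡₂-intro (divides -[1+ 0 ] refl)

LowerLeftEven : Mat 4 → Set
LowerLeftEven M = ∀ (i j : Fin 2) → + 2 ∣ M (suc (suc i)) (j ↑ˡ 2)

ω₀₁ : Mat 4 → ℤ
ω₀₁ V = (transpose V · J · V) f0 f1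

-- Every term of ω₀₁ Y contains an entry of the lower-left block of Y or a zero entry of J.
lowerLeftEven⇒ω₀₁-even : ∀ Y → LowerLeftEven Y → + 2 ∣ ω₀₁ Y
lowerLeftEven⇒ω₀₁-even Y ev = ∣-sum4 (λ k → (transpose Y · J) f0 k * Y k f1) λ where
    f0 → ∣m⇒∣m*n (Y f0 f1) (∣-sum4 (λ l → Y l f0 * J l f0) λ where
           f0 → 2∣x*0 (Y f0 f0) ; f1 → 2∣x*0 (Y f1 f0)
           f2 → ∣m⇒∣m*n -[1+ 0 ] (ev f0 f0) ; f3 → 2∣x*0 (Y f3 f0))
    f1 → ∣m⇒∣m*n (Y f1 f1) (∣-sum4 (λ l → Y l f0 * J l f1) λ where
           f0 → 2∣x*0 (Y f0 f0) ; f1 → 2∣x*0 (Y f1 f0)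
           f2 → 2∣x*0 (Y f2 f0) ; f3 → ∣m⇒∣m*n -[1+ 0 ] (ev f1 f0))
    f2 → ∣n⇒∣m*n ((transpose Y · J) f0 f2) (ev f0 f1)
    f3 → ∣n⇒∣m*n ((transpose Y · J) f0 f3) (ev f1 f1)
  where
  2∣x*0 : ∀ x → + 2 ∣ x * + 0
  2∣x*0 x = ∣n⇒∣m*n x (divides (+ 0) refl)

ω₀₁-even : ∀ g V → InSp g → LowerLeftEven (g · V) → + 2 ∣ ω₀₁ V
ω₀₁-even g V spg ev =
  subst (+ 2 ∣_) (form-invariant g V spg f0 f1) (lowerLeftEven⇒ω₀₁-even (g · V) ev)

_⊙_ : Vec Bool 4 → (Fin 4 → ℤ) → ℤ
r ⊙ v = sum4 λ k → ⟦ lookup r k ⟧ * v k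

Kills : Vec (Vec Bool 4) 2 → Mat 4 → Set
Kills R X = ∀ (i j : Fin 2) → + 2 ∣ lookup R i ⊙ (λ k → X k (j ↑ˡ 2))

kills? : ∀ R X → Dec (Kills R X)
kills? R X = all? λ i → all? λ j → + 2 ∣? lookup R i ⊙ (λ k → X k (j ↑ˡ 2))

parityRow : Mat 4 → Fin 4 → Vec Bool 4
parityRow g r = tabulate λ k → parity (g r k)

lowerRows : Mat 4 → Vec (Vec Bool 4) 2
lowerRows g = tabulate λ i → parityRow g (suc (suc i))

·≡₂parityRow⊙ : ∀ g X r c → (g · X) r c ≡₂ parityRow g r ⊙ (λ k → X k c)
·≡₂parityRow⊙ g X r c = ≡₂-sum4 λ k → ≡₂-* (≡₂-parity (g r k)) (≡₂-refl {X k c})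

kills⇒lowerLeftEven : ∀ g X → Kills (lowerRows g) X → LowerLeftEven (g · X)
kills⇒lowerLeftEven g X kills f0 j = ∣-resp-≡₂ (·≡₂parityRow⊙ g X f2 (j ↑ˡ 2)) (kills f0 j)
kills⇒lowerLeftEven g X kills f1 j = ∣-resp-≡₂ (·≡₂parityRow⊙ g X f3 (j ↑ˡ 2)) (kills f1 j)

minor : Mat 4 → ℤ
minor M = M f2 f0 * M f3 f2 - M f2 f2 * M f3 f0

minor-cong : ∀ {A B} → A ≈ B → minor A ≡ minor B
minor-cong A≈B = cong₂ _-_ (cong₂ _*_ (A≈B f2 f0) (A≈B f3 f2)) (cong₂ _*_ (A≈B f2 f2) (A≈B f3 f0))

-- Columns 0 and 2 of A · ι G H only involve columns 0 and 2 of A and the matrix G.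
minor-·ι : ∀ A G H → minor (A · ι G H) ≡ minor A * det2 G
minor-·ι A G H = cauchyBinet (A f2 f0) (A f2 f1) (A f2 f2) (A f2 f3) (A f3 f0) (A f3 f1) (A f3 f2) (A f3 f3)
                             (G f0 f0) (G f0 f1) (G f1 f0) (G f1 f1)
  where
  cauchyBinet : ∀ x₀ x₁ x₂ x₃ y₀ y₁ y₂ y₃ a b c d →
    (x₀ * a + (x₁ * + 0 + (x₂ * c + x₃ * + 0))) * (y₀ * b + (y₁ * + 0 + (y₂ * d + y₃ * + 0)))
      - (x₀ * b + (x₁ * + 0 + (x₂ * d + x₃ * + 0))) * (y₀ * a + (y₁ * + 0 + (y₂ * c + y₃ * + 0)))
    ≡ (x₀ * y₂ - x₂ * y₀) * (a * d - b * c)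
  cauchyBinet = solve-∀

minor-even : ∀ A → LowerLeftEven A → + 2 ∣ minor A
minor-even A ev = ∣m∣n⇒∣m-n (∣m⇒∣m*n (A f3 f2) (ev f0 f0)) (∣n⇒∣m*n (A f2 f2) (ev f1 f0))

M₁∉Γ₀2·Γdiag : ¬ SameDoubleCoset M₁ one4
M₁∉Γ₀2·Γdiag (γ , δ , (_ , γ-even) , (G , H , detG≡1 , _ , δ≈ιGH) , M₁≈γδ) =
  2∤-1 (subst (+ 2 ∣_) (sym minor-M₁) (minor-even γ λ i j → ∣ᵤ⇒∣ (γ-even i j)))
  where
  open ≡-Reasoning
  minor-M₁ : minor M₁ ≡ minor γ
  minor-M₁ = begin
    minor M₁                         ≡⟨ minor-cong M₁≈γδ ⟩
    minor (γ · one4 · δ)             ≡⟨ minor-cong (·-congˡ (γ · one4) δ≈ιGH) ⟩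
    minor (γ · one4 · ι G H)         ≡⟨ minor-·ι (γ · one4) G H ⟩
    minor (γ · one4) * det2 G        ≡⟨ cong (minor (γ · one4) *_) detG≡1 ⟩
    minor (γ · one4) * + 1           ≡⟨ *-identityʳ (minor (γ · one4)) ⟩
    minor (γ · one4)                 ≡⟨ minor-cong (·-identityʳ γ) ⟩
    minor γ                          ∎

-- Frames and the finite search

m2 : ℤ → ℤ → ℤ → ℤ → Mat2
m2 a b c d f0 f0 = a
m2 a b c d f0 f1 = b
m2 a b c d f1 f0 = c
m2 a b c d f1 f1 = d

adj : Mat2 → Mat2
adj g = m2 (g f1 f1) (- g f0 f1) (- g f1 f0) (g f0 f0)

-- Lifts of the six elements of SL₂(𝔽₂).
sl2-lifts : Vec Mat2 6
sl2-lifts = m2 (+ 1) (+ 0) (+ 0) (+ 1) ∷ m2 (+ 0) (+ 1) -[1+ 0 ] (+ 0) ∷ m2 (+ 1) (+ 1) (+ 0) (+ 1)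
          ∷ m2 (+ 1) (+ 0) (+ 1) (+ 1) ∷ m2 (+ 0) (+ 1) -[1+ 0 ] (+ 1) ∷ m2 (+ 1) (+ 1) -[1+ 0 ] (+ 0)
          ∷ []

sl2-lifts-InSL2 : ∀ i → InSL2 (lookup sl2-lifts i)
sl2-lifts-InSL2 = from-yes (all? λ i → det2 (lookup sl2-lifts i) ≟ + 1)

M₁⁻¹ : Mat 4
M₁⁻¹ = fromRows ( (+ 1 ∷ + 0 ∷ + 0 ∷ + 0 ∷ [])
                ∷ (+ 0 ∷ + 1 ∷ + 0 ∷ + 0 ∷ [])
                ∷ (+ 0 ∷ -[1+ 0 ] ∷ + 1 ∷ + 0 ∷ [])
                ∷ (-[1+ 0 ] ∷ + 0 ∷ + 0 ∷ + 1 ∷ [])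
                ∷ [])

rep : Bool → Mat 4
rep false = one4
rep true = M₁

rep⁻¹ : Bool → Mat 4
rep⁻¹ false = one4
rep⁻¹ true = M₁⁻¹

-- (i , j , t) encodes δ = ι Gᵢ Gⱼ, where Gᵢ = lookup sl2-lifts i, and r = rep t;
-- its frame matrix is δ⁻¹ r⁻¹.
Frame : Set
Frame = Fin 6 × Fin 6 × Bool

∃?-Frame : Exhaustible Frame
∃?-Frame = ∃?-× any? (∃?-× any? ∃?-Bool)

diagPart : Frame → Mat 4
diagPart (i , j , _) = ι (lookup sl2-lifts i) (lookup sl2-lifts j)

frameMatrix : Frame → Mat 4
frameMatrix (i , j , t) = ι (adj (lookup sl2-lifts i)) (adj (lookup sl2-lifts j)) · rep⁻¹ t

ValidFrame : Frame → Set
ValidFrame f@(_ , _ , t) = InSp (frameMatrix f) × frameMatrix f · rep t · diagPart f ≈ one4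

frames-valid : ∀ f → ValidFrame f
frames-valid = from-yes (∀? ∃?-Frame λ f@(_ , _ , t) →
  InSp? (frameMatrix f) ×-dec (frameMatrix f · rep t · diagPart f ≈? one4))

twoColumns : Vec Bool 4 × Vec Bool 4 → Mat 4
twoColumns (x , y) i f0 = ⟦ lookup x i ⟧
twoColumns (x , y) i f1 = ⟦ lookup y i ⟧
twoColumns (x , y) i (suc (suc _)) = + 0

KillsFrameOrHyperbolicPair : Vec (Vec Bool 4) 2 → Set
KillsFrameOrHyperbolicPair R =
  (∃[ f ] Kills R (frameMatrix f)) ⊎ (∃[ p ] Kills R (twoColumns p) × ¬ + 2 ∣ ω₀₁ (twoColumns p))

-- Opaque, so that use sites do not unfold the closed computation.
opaque
  killsFrameOrHyperbolicPair : ∀ R → KillsFrameOrHyperbolicPair R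
  killsFrameOrHyperbolicPair = from-yes (∀? (∃?-Vec ∃?-𝔽₂⁴ 2) λ R →
    ∃?-Frame (λ f → kills? R (frameMatrix f))
    ⊎-dec ∃?-× ∃?-𝔽₂⁴ ∃?-𝔽₂⁴ (λ p → kills? R (twoColumns p) ×-dec ¬? (+ 2 ∣? ω₀₁ (twoColumns p))))
    where
    ∃?-𝔽₂⁴ : Exhaustible (Vec Bool 4)
    ∃?-𝔽₂⁴ = ∃?-Vec ∃?-Bool 4

SameDoubleCoset-rep : ∀ {g} t → SameDoubleCoset g (rep t) → SameDoubleCoset g one4 ⊎ SameDoubleCoset g M₁
SameDoubleCoset-rep false = inj₁
SameDoubleCoset-rep true = inj₂

frame⇒SameDoubleCoset : ∀ {g} → InSp g → ∀ i j t → LowerLeftEven (g · frameMatrix (i , j , t)) →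
                        SameDoubleCoset g (rep t)
frame⇒SameDoubleCoset {g} spg i j t ev =
  g · X , δ , (InSp-· g X spg (proj₁ (frames-valid f)) , λ a b → ∣⇒∣ᵤ (ev a b)) ,
  (lookup sl2-lifts i , lookup sl2-lifts j , sl2-lifts-InSL2 i , sl2-lifts-InSL2 j , λ _ _ → refl) ,
  g≈gXrδ
  where
  f : Frame
  f = (i , j , t)
  X δ : Mat 4
  X = frameMatrix f
  δ = diagPart f
  g≈gXrδ : g ≈ g · X · rep t · δ
  g≈gXrδ = begin
    g                       ≈⟨ ·-identityʳ g ⟨
    g · one4                ≈⟨ ·-congˡ g (proj₂ (frames-valid f)) ⟨
    g · (X · rep t · δ)     ≈⟨ ·-assoc g (X · rep t) δ ⟨
    g · (X · rep t) · δ     ≈⟨ ·-congʳ δ (·-assoc g X (rep t)) ⟨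
    g · X · rep t · δ       ∎
    where open SetoidReasoning ≈-setoid

InSp⇒SameDoubleCoset-one4⊎M₁ : ∀ g → InSp g → SameDoubleCoset g one4 ⊎ SameDoubleCoset g M₁
InSp⇒SameDoubleCoset-one4⊎M₁ g spg with killsFrameOrHyperbolicPair (lowerRows g)
... | inj₁ (f@(i , j , t) , kills) =
  SameDoubleCoset-rep t (frame⇒SameDoubleCoset spg i j t (kills⇒lowerLeftEven g (frameMatrix f) kills))
... | inj₂ (p , kills , odd) =
  ⊥-elim (odd (ω₀₁-even g (twoColumns p) spg (kills⇒lowerLeftEven g (twoColumns p) kills)))

lemma3p2 : (InSp one4 × InSp M₁)
    × (∀ (g : Mat 4) → InSp g → SameDoubleCoset g one4 ⊎ SameDoubleCoset g M₁)
    × ¬ SameDoubleCoset M₁ one4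
lemma3p2 =
  (from-yes (InSp? one4) , from-yes (InSp? M₁)) ,
  InSp⇒SameDoubleCoset-one4⊎M₁ ,
  M₁∉Γ₀2·Γdiag
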